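{- Let $k\in[n-1]$, $w\in S_n^{k\searrow}$ and $k'\le k$ with $k'\in[n-1]$. If $u\in S_n$ satisfies $u\le_{k'}w$, then $u\in S_n^{k\searrow}$.
   Context: For $k\in\{0,\dots,n-1\}$, $S_n^{k\searrow}=\{w\in S_n: w(k+1)>w(k+2)>\dots>w(n)\}$. $t_{i,j}$ is the transposition of $i<j$, $\ell$ the inversion number; $u\lessdot w$ if $w=ut_{i,j}$ and $\ell(w)=\ell(u)+1$; $u\lessdot_{k'}w$ if moreover $i\le k'<j$. The $k'$-Bruhat order $\le_{k'}$ is the partial order generated by the covers $\lessdot_{k'}$. -}

module Defs where

open import Data.Nat using (ℕ; suc; _≤_) renaming (_<_ to _<ℕ_)
open import Data.Fin using (Fin; toℕ; _<_)
open import Data.Fin.Properties using (_<?_)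
open import Data.Fin.Permutation using (Permutation′; _⟨$⟩ʳ_; transpose)
open import Data.List using (List; length; filter; cartesianProduct)
open import Data.List using () renaming (allFin to allFinL)
open import Data.Product using (_×_; _,_; ∃₂)
open import Relation.Binary.PropositionalEquality using (_≡_)
open import Relation.Binary.Construct.Closure.ReflexiveTransitive using (Star)
open import Relation.Unary using (Decidable)
open import Relation.Nullary.Decidable using (_×-dec_)

-- S_n : permutations of Fin n; positions and values are 0-indexed
-- (paper's position/value p corresponds to the Fin element with toℕ = p - 1).
Perm : ℕ → Set
Perm n = Permutation′ n

-- S_n^{k↘}: w(k+1) > w(k+2) > ... > w(n)  (paper indexing),
-- i.e. w is decreasing on the 0-indexed positions ≥ k.
Desc : ∀ {n} → ℕ → Perm n → Set
Desc {n} k w = ∀ (i j : Fin n) → k ≤ toℕ i → i < j → (w ⟨$⟩ʳ j) < (w ⟨$⟩ʳ i)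

isInv : ∀ {n} (w : Perm n) → Decidable (λ (p : Fin n × Fin n) → let (i , j) = p in i < j × (w ⟨$⟩ʳ j) < (w ⟨$⟩ʳ i))
isInv w (i , j) = (i <? j) ×-dec ((w ⟨$⟩ʳ j) <? (w ⟨$⟩ʳ i))

ℓ : ∀ {n} → Perm n → ℕ
ℓ {n} w = length (filter (isInv w) (cartesianProduct (allFinL n) (allFinL n)))

-- u ⋖_{k'} w : w = u t_{i,j} (i.e. w(x) = u(t_{i,j}(x)) for all x), ℓ(w) = ℓ(u)+1,
-- and i ≤ k' < j in paper's 1-indexing, i.e. toℕ i < k' ≤ toℕ j for 0-indexed i j.
KCover : ∀ {n} → ℕ → Perm n → Perm n → Set
KCover {n} k′ u w =
  ∃₂ λ (i j : Fin n) → i < j × toℕ i <ℕ k′ × k′ ≤ toℕ j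
    × (∀ x → w ⟨$⟩ʳ x ≡ u ⟨$⟩ʳ (transpose i j ⟨$⟩ʳ x))
    × ℓ w ≡ suc (ℓ u)

_≤[_]_ : ∀ {n} → Perm n → ℕ → Perm n → Set
u ≤[ k′ ] w = Star (KCover k′) u w

-- Write a k′-cover as v = u t_{i,j} with i ≤ k′ < j.  Multiplying by t_{i,j} on the right raises
-- the inversion number by at least one when u(i) < u(j), and by at least three when moreover some
-- position m between i and j has u(i) < u(m) < u(j), since t_{i,j} = t_{i,m} t_{m,j} t_{i,m} and each
-- of the three factors then swaps an ascent.  As ℓ(v) = ℓ(u) + 1, we get u(i) < u(j) with no value
-- of u strictly between them at the positions between i and j.  Since i ≤ k′ ≤ k, passing from v to u
-- changes only the value at j among the positions after k: it grows from v(j) to v(i), which keeps it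
-- above the later values and, as no value is skipped, below the earlier ones.

module Submission where

open import Defs
open import Data.Nat using (ℕ; _≤_; _<_; zero; suc; _+_; z≤n; s≤s)
import Data.Nat.Properties as ℕ
open import Data.Nat.Tactic.RingSolver using (solve-∀)
import Data.Nat.ListAction as List
open import Data.Nat.ListAction.Properties using (sum-++)
open import Data.Fin as Fin using (Fin; toℕ; _≟_) renaming (_<_ to _<ᶠ_)
import Data.Fin.Properties as Fin
open import Data.Fin.Permutation using (_⟨$⟩ʳ_; transpose; _∘ₚ_)
open import Data.Fin.Permutation.Components using () renaming (transpose to τ)
open import Data.Vec.Functional using (updateAt)
open import Data.Vec.Functional.Properties using (updateAt-updates; updateAt-minimal)
open import Algebra.Properties.CommutativeMonoid.Sum ℕ.+-0-commutativeMonoid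
  using (sum; sum-syntax; sum-cong-≗; ∑-distrib-+)
open import Data.List using (List; []; _∷_; length; filter; map; _++_; tabulate; cartesianProduct)
open import Data.List.Properties using (map-++; map-∘)
open import Data.Bool using (true; false; if_then_else_)
open import Data.Product using (_×_; _,_; proj₁; proj₂)
open import Data.Empty using (⊥-elim)
open import Function using (_∘_; id; const)
open import Function.Bundles using (Injection)
open import Function.Properties.Inverse using (↔⇒↣)
open import Relation.Nullary using (Dec; yes; no; ¬_; does)
open import Relation.Unary using (Decidable)
open import Relation.Binary using (tri<; tri≈; tri>)
open import Relation.Binary.PropositionalEquality
open import Relation.Binary.Construct.Closure.ReflexiveTransitive using (ε; _◅_)

𝟙 : ∀ {P : Set} → Dec P → ℕ
𝟙 d = if does d then 1 else 0

𝟙-yes : ∀ {P : Set} (d : Dec P) → P → 𝟙 d ≡ 1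
𝟙-yes (yes _) _ = refl
𝟙-yes (no ¬p) p = ⊥-elim (¬p p)

𝟙-no : ∀ {P : Set} (d : Dec P) → ¬ P → 𝟙 d ≡ 0
𝟙-no (yes p) ¬p = ⊥-elim (¬p p)
𝟙-no (no _) _ = refl

𝟙-mono : ∀ {P Q : Set} (p : Dec P) (q : Dec Q) → (P → Q) → 𝟙 p ≤ 𝟙 q
𝟙-mono (yes p) (yes q) _ = ℕ.≤-refl
𝟙-mono (yes p) (no ¬q) f = ⊥-elim (¬q (f p))
𝟙-mono (no _) _ _ = z≤n

∑-mono-≤ : ∀ {n} {f g : Fin n → ℕ} → (∀ b → f b ≤ g b) → sum f ≤ sum g
∑-mono-≤ {zero} _ = z≤n
∑-mono-≤ {suc n} f≤g = ℕ.+-mono-≤ (f≤g Fin.zero) (∑-mono-≤ (f≤g ∘ Fin.suc))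

∑-extract : ∀ {n} (i : Fin n) (f : Fin n → ℕ) → sum f ≡ f i + sum (updateAt f i (const 0))
∑-extract Fin.zero f = refl
∑-extract (Fin.suc i) f = begin
  f Fin.zero + sum (f ∘ Fin.suc)
    ≡⟨ cong (f Fin.zero +_) (∑-extract i (f ∘ Fin.suc)) ⟩
  f Fin.zero + (f (Fin.suc i) + sum (updateAt (f ∘ Fin.suc) i (const 0)))
    ≡⟨ left-comm (f Fin.zero) (f (Fin.suc i)) _ ⟩
  f (Fin.suc i) + (f Fin.zero + sum (updateAt (f ∘ Fin.suc) i (const 0))) ∎
  where
  open ≡-Reasoning
  left-comm : ∀ a b c → a + (b + c) ≡ b + (a + c)
  left-comm = solve-∀

∑-exchange-≤ : ∀ {n} {f g : Fin n → ℕ} {i j : Fin n} (c : ℕ) → i ≢ j →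
  (∀ b → b ≢ i → b ≢ j → f b ≤ g b) → f i + f j + c ≤ g i + g j → sum f + c ≤ sum g
∑-exchange-≤ {f = f} {g} {i} {j} c i≢j f≤g-elsewhere f≤g-at-ij = begin
  sum f + c                         ≡⟨ cong (_+ c) (split f) ⟩
  f i + f j + sum (erase f) + c     ≡⟨ move-c (f i + f j) (sum (erase f)) c ⟩
  f i + f j + c + sum (erase f)     ≤⟨ ℕ.+-mono-≤ f≤g-at-ij (∑-mono-≤ erased-≤) ⟩
  g i + g j + sum (erase g)         ≡⟨ split g ⟨
  sum g                             ∎
  where
  open ℕ.≤-Reasoning
  move-c : ∀ a r c → a + r + c ≡ a + c + r
  move-c = solve-∀

  erase : (Fin _ → ℕ) → Fin _ → ℕ
  erase h = updateAt (updateAt h i (const 0)) j (const 0)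

  split : ∀ h → sum h ≡ h i + h j + sum (erase h)
  split h = begin-equality
    sum h                                              ≡⟨ ∑-extract i h ⟩
    h i + sum (updateAt h i (const 0))                 ≡⟨ cong (h i +_) (∑-extract j _) ⟩
    h i + (updateAt h i (const 0) j + sum (erase h))
      ≡⟨ cong (λ x → h i + (x + sum (erase h))) (updateAt-minimal j i h (i≢j ∘ sym)) ⟩
    h i + (h j + sum (erase h))                        ≡⟨ ℕ.+-assoc (h i) _ _ ⟨
    h i + h j + sum (erase h)                          ∎

  erased-≤ : ∀ b → erase f b ≤ erase g b
  erased-≤ b with b ≟ i | b ≟ j
  ... | _ | yes refl = ℕ.≤-reflexive (trans (updateAt-updates j _) (sym (updateAt-updates j _)))
  ... | yes refl | no b≢j = ℕ.≤-reflexive (begin-equality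
    erase f i ≡⟨ updateAt-minimal i j _ b≢j ⟩
    updateAt f i (const 0) i ≡⟨ updateAt-updates i f ⟩
    0 ≡⟨ updateAt-updates i g ⟨
    updateAt g i (const 0) i ≡⟨ updateAt-minimal i j _ b≢j ⟨
    erase g i ∎)
  ... | no b≢i | no b≢j = begin
    erase f b ≡⟨ trans (updateAt-minimal b j _ b≢j) (updateAt-minimal b i f b≢i) ⟩
    f b ≤⟨ f≤g-elsewhere b b≢i b≢j ⟩
    g b ≡⟨ trans (updateAt-minimal b j _ b≢j) (updateAt-minimal b i g b≢i) ⟨
    erase g b ∎

length-filter≡sum-𝟙 : ∀ {A : Set} {P : A → Set} (P? : Decidable P) (xs : List A) →
  length (filter P? xs) ≡ List.sum (map (𝟙 ∘ P?) xs)
length-filter≡sum-𝟙 P? [] = refl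
length-filter≡sum-𝟙 P? (x ∷ xs) with does (P? x)
... | true = cong suc (length-filter≡sum-𝟙 P? xs)
... | false = length-filter≡sum-𝟙 P? xs

sum-map-cartesianProduct : ∀ {A B : Set} (h : A × B → ℕ) (xs : List A) (ys : List B) →
  List.sum (map h (cartesianProduct xs ys)) ≡ List.sum (map (λ x → List.sum (map (λ y → h (x , y)) ys)) xs)
sum-map-cartesianProduct h [] ys = refl
sum-map-cartesianProduct h (x ∷ xs) ys = begin
  List.sum (map h (map (x ,_) ys ++ cartesianProduct xs ys))
    ≡⟨ cong List.sum (map-++ h (map (x ,_) ys) _) ⟩
  List.sum (map h (map (x ,_) ys) ++ map h (cartesianProduct xs ys))
    ≡⟨ sum-++ (map h (map (x ,_) ys)) _ ⟩
  List.sum (map h (map (x ,_) ys)) + List.sum (map h (cartesianProduct xs ys))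
    ≡⟨ cong₂ _+_ (cong List.sum (sym (map-∘ ys))) (sum-map-cartesianProduct h xs ys) ⟩
  List.sum (map (λ y → h (x , y)) ys) + List.sum (map (λ x → List.sum (map (λ y → h (x , y)) ys)) xs) ∎
  where open ≡-Reasoning

sum-map-tabulate : ∀ {A : Set} {n} (h : A → ℕ) (f : Fin n → A) → List.sum (map h (tabulate f)) ≡ sum (h ∘ f)
sum-map-tabulate {n = zero} h f = refl
sum-map-tabulate {n = suc n} h f = cong (h (f Fin.zero) +_) (sum-map-tabulate h (f ∘ Fin.suc))

inversion : ∀ {n} → Perm n → Fin n → Fin n → ℕ
inversion w a b = 𝟙 (isInv w (a , b))

row : ∀ {n} → Perm n → Fin n → ℕ
row {n} w a = ∑[ b < n ] inversion w a b

ℓ≡∑row : ∀ {n} (w : Perm n) → ℓ w ≡ ∑[ a < n ] row w a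
ℓ≡∑row {n} w = begin
  ℓ w
    ≡⟨ length-filter≡sum-𝟙 (isInv w) (cartesianProduct (tabulate id) (tabulate id)) ⟩
  List.sum (map (𝟙 ∘ isInv w) (cartesianProduct (tabulate id) (tabulate id)))
    ≡⟨ sum-map-cartesianProduct (𝟙 ∘ isInv w) (tabulate id) (tabulate id) ⟩
  List.sum (map (λ a → List.sum (map (inversion w a) (tabulate id))) (tabulate id))
    ≡⟨ sum-map-tabulate (λ a → List.sum (map (inversion w a) (tabulate id))) id ⟩
  ∑[ a < n ] List.sum (map (inversion w a) (tabulate id))
    ≡⟨ sum-cong-≗ (λ a → sum-map-tabulate (inversion w a) id) ⟩
  ∑[ a < n ] row w a ∎
  where open ≡-Reasoning

τ-matchˡ : ∀ {n} (i j : Fin n) → τ i j i ≡ j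
τ-matchˡ i j with i ≟ i
... | yes _ = refl
... | no i≢i = ⊥-elim (i≢i refl)

τ-matchʳ : ∀ {n} (i j : Fin n) → τ i j j ≡ i
τ-matchʳ i j with j ≟ i
... | yes j≡i = j≡i
... | no _ with j ≟ j
...   | yes _ = refl
...   | no j≢j = ⊥-elim (j≢j refl)

τ-mismatch : ∀ {n} (i j : Fin n) {k} → k ≢ i → k ≢ j → τ i j k ≡ k
τ-mismatch i j {k} k≢i k≢j with k ≟ i
... | yes k≡i = ⊥-elim (k≢i k≡i)
... | no _ with k ≟ j
...   | yes k≡j = ⊥-elim (k≢j k≡j)
...   | no _ = refl

τ-involutive : ∀ {n} (i j k : Fin n) → τ i j (τ i j k) ≡ k
τ-involutive i j k = by-cases (k ≟ i) (k ≟ j)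
  where
  by-cases : Dec (k ≡ i) → Dec (k ≡ j) → τ i j (τ i j k) ≡ k
  by-cases (yes refl) _ rewrite τ-matchˡ i j = τ-matchʳ i j
  by-cases (no _) (yes refl) rewrite τ-matchʳ i j = τ-matchˡ i j
  by-cases (no k≢i) (no k≢j) rewrite τ-mismatch i j k≢i k≢j = τ-mismatch i j k≢i k≢j

τ-conjugate : ∀ {n} {i m j : Fin n} → i ≢ m → m ≢ j → i ≢ j → ∀ k → τ i m (τ m j (τ i m k)) ≡ τ i j k
τ-conjugate {i = i} {m} {j} i≢m m≢j i≢j k = by-cases (k ≟ i) (k ≟ m) (k ≟ j)
  where
  by-cases : Dec (k ≡ i) → Dec (k ≡ m) → Dec (k ≡ j) → τ i m (τ m j (τ i m k)) ≡ τ i j k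
  by-cases (yes refl) _ _
    rewrite τ-matchˡ i m | τ-matchˡ m j | τ-mismatch i m (i≢j ∘ sym) (m≢j ∘ sym) | τ-matchˡ i j = refl
  by-cases (no k≢i) (yes refl) _
    rewrite τ-matchʳ i m | τ-mismatch m j i≢m i≢j | τ-matchˡ i m | τ-mismatch i j k≢i m≢j = refl
  by-cases (no k≢i) (no k≢m) (yes refl)
    rewrite τ-mismatch i m k≢i k≢m | τ-matchʳ m j | τ-matchʳ i m | τ-matchʳ i j = refl
  by-cases (no k≢i) (no k≢m) (no k≢j)
    rewrite τ-mismatch i m k≢i k≢m | τ-mismatch m j k≢m k≢j | τ-mismatch i m k≢i k≢m
          | τ-mismatch i j k≢i k≢j = refl

-- v = w t_{i,j}; a record rather than a bare function type, so that i and j are inferable from a proof.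
record _≗_∘τ[_,_] {n} (v w : Perm n) (i j : Fin n) : Set where
  constructor mk∘τ
  field
    apply : ∀ x → v ⟨$⟩ʳ x ≡ w ⟨$⟩ʳ τ i j x

open _≗_∘τ[_,_] using (apply)

module _ {n} {v w : Perm n} {i j : Fin n} (v≗wτ : v ≗ w ∘τ[ i , j ]) where

  ∘τ-matchˡ : v ⟨$⟩ʳ i ≡ w ⟨$⟩ʳ j
  ∘τ-matchˡ = trans (apply v≗wτ i) (cong (w ⟨$⟩ʳ_) (τ-matchˡ i j))

  ∘τ-matchʳ : v ⟨$⟩ʳ j ≡ w ⟨$⟩ʳ i
  ∘τ-matchʳ = trans (apply v≗wτ j) (cong (w ⟨$⟩ʳ_) (τ-matchʳ i j))

  ∘τ-mismatch : ∀ {x} → x ≢ i → x ≢ j → v ⟨$⟩ʳ x ≡ w ⟨$⟩ʳ x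
  ∘τ-mismatch x≢i x≢j = trans (apply v≗wτ _) (cong (w ⟨$⟩ʳ_) (τ-mismatch i j x≢i x≢j))

  ∘τ-sym : w ≗ v ∘τ[ i , j ]
  ∘τ-sym = mk∘τ λ x → trans (cong (w ⟨$⟩ʳ_) (sym (τ-involutive i j x))) (sym (apply v≗wτ (τ i j x)))

-- Row by row, and inside rows i and j column by column, the inversions of w are matched with
-- inversions of v (the entries at i and j possibly exchanged); the pair (i , j) is a new one.
module _ {n} {w v : Perm n} {i j : Fin n} (i<j : i <ᶠ j) (wi<wj : w ⟨$⟩ʳ i <ᶠ w ⟨$⟩ʳ j)
         (v≗wτ : v ≗ w ∘τ[ i , j ]) where

  private
    i≢j : i ≢ j
    i≢j = Fin.<⇒≢ i<j

    vi : v ⟨$⟩ʳ i ≡ w ⟨$⟩ʳ j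
    vi = ∘τ-matchˡ v≗wτ

    vj : v ⟨$⟩ʳ j ≡ w ⟨$⟩ʳ i
    vj = ∘τ-matchʳ v≗wτ

    inversion-≤ : ∀ a b c d → (a <ᶠ b → c <ᶠ d) → (w ⟨$⟩ʳ b <ᶠ w ⟨$⟩ʳ a → v ⟨$⟩ʳ d <ᶠ v ⟨$⟩ʳ c) →
                  inversion w a b ≤ inversion v c d
    inversion-≤ a b c d f g = 𝟙-mono (isInv w (a , b)) (isInv v (c , d)) λ (a<b , wb<wa) → f a<b , g wb<wa

    v<v : ∀ {a b a′ b′} → v ⟨$⟩ʳ a ≡ w ⟨$⟩ʳ a′ → v ⟨$⟩ʳ b ≡ w ⟨$⟩ʳ b′ →
          w ⟨$⟩ʳ a′ <ᶠ w ⟨$⟩ʳ b′ → v ⟨$⟩ʳ a <ᶠ v ⟨$⟩ʳ b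
    v<v va vb = subst₂ _<ᶠ_ (sym va) (sym vb)

    crossed : ∀ {a b c d} → a ≤ d → b ≤ c → a + b ≤ c + d
    crossed {a} {b} {c} {d} a≤d b≤c = subst (a + b ≤_) (ℕ.+-comm d c) (ℕ.+-mono-≤ a≤d b≤c)

    row-elsewhere-≤ : ∀ a → a ≢ i → a ≢ j → row w a ≤ row v a
    row-elsewhere-≤ a a≢i a≢j =
      subst (_≤ row v a) (ℕ.+-identityʳ (row w a)) (∑-exchange-≤ 0 i≢j columns-elsewhere columns-ij)
      where
      va = ∘τ-mismatch v≗wτ a≢i a≢j
      columns-elsewhere : ∀ b → b ≢ i → b ≢ j → inversion w a b ≤ inversion v a b
      columns-elsewhere b b≢i b≢j = inversion-≤ a b a b id (v<v (∘τ-mismatch v≗wτ b≢i b≢j) va)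
      columns-ij : inversion w a i + inversion w a j + 0 ≤ inversion v a i + inversion v a j
      columns-ij rewrite ℕ.+-identityʳ (inversion w a i + inversion w a j) with Fin.<-cmp a i
      ... | tri< a<i _ _ = crossed (inversion-≤ a i a j (const (Fin.<-trans a<i i<j)) (v<v vj va))
                                   (inversion-≤ a j a i (const a<i) (v<v vi va))
      ... | tri≈ _ a≡i _ = ⊥-elim (a≢i a≡i)
      ... | tri> _ _ i<a = ℕ.+-mono-≤ (𝟙-mono (isInv w (a , i)) (isInv v (a , i))
                                               (λ (a<i , _) → ⊥-elim (Fin.<-asym a<i i<a)))
                                      (inversion-≤ a j a j id (λ wj<wa → v<v vj va (Fin.<-trans wi<wj wj<wa)))

    rows-ij-≤ : row w i + row w j + 1 ≤ row v i + row v j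
    rows-ij-≤ = subst₂ (λ x y → x + 1 ≤ y) (∑-distrib-+ (inversion w i) (inversion w j))
                  (∑-distrib-+ (inversion v i) (inversion v j))
                  (∑-exchange-≤ 1 i≢j columns-elsewhere columns-ij)
      where
      columns-elsewhere : ∀ b → b ≢ i → b ≢ j →
        inversion w i b + inversion w j b ≤ inversion v i b + inversion v j b
      columns-elsewhere b b≢i b≢j with Fin.<-cmp j b
      ... | tri< j<b _ _ = crossed (inversion-≤ i b j b (const j<b) (v<v vb vj))
                                   (inversion-≤ j b i b (const (Fin.<-trans i<j j<b)) (v<v vb vi))
        where vb = ∘τ-mismatch v≗wτ b≢i b≢j
      ... | tri≈ _ j≡b _ = ⊥-elim (b≢j (sym j≡b))
      ... | tri> _ _ b<j = ℕ.+-mono-≤ (inversion-≤ i b i b id (λ wb<wi → v<v vb vi (Fin.<-trans wb<wi wi<wj)))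
                                      (𝟙-mono (isInv w (j , b)) (isInv v (j , b))
                                              (λ (j<b , _) → ⊥-elim (Fin.<-asym j<b b<j)))
        where vb = ∘τ-mismatch v≗wτ b≢i b≢j
      columns-ij : inversion w i i + inversion w j i + (inversion w i j + inversion w j j) + 1
                   ≤ inversion v i i + inversion v j i + (inversion v i j + inversion v j j)
      columns-ij
        rewrite 𝟙-no (isInv w (i , i)) (Fin.<-irrefl refl ∘ proj₁)
              | 𝟙-no (isInv w (j , i)) (Fin.<-asym i<j ∘ proj₁)
              | 𝟙-no (isInv w (i , j)) (Fin.<-asym wi<wj ∘ proj₂)
              | 𝟙-no (isInv w (j , j)) (Fin.<-irrefl refl ∘ proj₁)
              | 𝟙-yes (isInv v (i , j)) (i<j , v<v vj vi wi<wj)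
              = ℕ.m≤n⇒m≤o+n _ (ℕ.m≤m+n 1 _)

  ℓ-increases-on-ascent : ℓ w < ℓ v
  ℓ-increases-on-ascent rewrite ℓ≡∑row w | ℓ≡∑row v =
    subst (_≤ sum (row v)) (ℕ.+-comm (sum (row w)) 1)
      (∑-exchange-≤ 1 i≢j row-elsewhere-≤ rows-ij-≤)

ℓ-increases-by-3-over-middle : ∀ {n} {w v : Perm n} {i m j : Fin n} → i <ᶠ m → m <ᶠ j →
  w ⟨$⟩ʳ i <ᶠ w ⟨$⟩ʳ m → w ⟨$⟩ʳ m <ᶠ w ⟨$⟩ʳ j → v ≗ w ∘τ[ i , j ] → 3 + ℓ w ≤ ℓ v
ℓ-increases-by-3-over-middle {w = w} {v} {i} {m} {j} i<m m<j wi<wm wm<wj v≗wτ =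
  ℕ.≤-trans (s≤s (s≤s ℓw<ℓw₁)) (ℕ.≤-trans (s≤s ℓw₁<ℓw₂) ℓw₂<ℓv)
  where
  i≢m = Fin.<⇒≢ i<m
  m≢j = Fin.<⇒≢ m<j
  i≢j = Fin.<⇒≢ (Fin.<-trans i<m m<j)

  w₁ = transpose i m ∘ₚ w
  w₂ = transpose m j ∘ₚ w₁

  w₁≗wτ : w₁ ≗ w ∘τ[ i , m ]
  w₁≗wτ = mk∘τ λ _ → refl

  w₂≗w₁τ : w₂ ≗ w₁ ∘τ[ m , j ]
  w₂≗w₁τ = mk∘τ λ _ → refl

  v≗w₂τ : v ≗ w₂ ∘τ[ i , m ]
  v≗w₂τ = mk∘τ λ x → trans (apply v≗wτ x) (cong (w ⟨$⟩ʳ_) (sym (τ-conjugate i≢m m≢j i≢j x)))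

  w₁m≡wi : w₁ ⟨$⟩ʳ m ≡ w ⟨$⟩ʳ i
  w₁m≡wi = ∘τ-matchʳ w₁≗wτ

  w₁j≡wj : w₁ ⟨$⟩ʳ j ≡ w ⟨$⟩ʳ j
  w₁j≡wj = ∘τ-mismatch w₁≗wτ (i≢j ∘ sym) (m≢j ∘ sym)

  w₂i≡wm : w₂ ⟨$⟩ʳ i ≡ w ⟨$⟩ʳ m
  w₂i≡wm = trans (∘τ-mismatch w₂≗w₁τ i≢m i≢j) (∘τ-matchˡ w₁≗wτ)

  w₂m≡wj : w₂ ⟨$⟩ʳ m ≡ w ⟨$⟩ʳ j
  w₂m≡wj = trans (∘τ-matchˡ w₂≗w₁τ) w₁j≡wj

  ℓw<ℓw₁ : ℓ w < ℓ w₁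
  ℓw<ℓw₁ = ℓ-increases-on-ascent i<m wi<wm w₁≗wτ

  ℓw₁<ℓw₂ : ℓ w₁ < ℓ w₂
  ℓw₁<ℓw₂ = ℓ-increases-on-ascent m<j
    (subst₂ _<ᶠ_ (sym w₁m≡wi) (sym w₁j≡wj) (Fin.<-trans wi<wm wm<wj)) w₂≗w₁τ

  ℓw₂<ℓv : ℓ w₂ < ℓ v
  ℓw₂<ℓv = ℓ-increases-on-ascent i<m (subst₂ _<ᶠ_ (sym w₂i≡wm) (sym w₂m≡wj) wm<wj) v≗w₂τ

⟨$⟩ʳ-injective : ∀ {n} (w : Perm n) {x y : Fin n} → w ⟨$⟩ʳ x ≡ w ⟨$⟩ʳ y → x ≡ y
⟨$⟩ʳ-injective w = Injection.injective (↔⇒↣ w)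

module _ {n} {u v : Perm n} {i j : Fin n} (i<j : i <ᶠ j) (v≗uτ : v ≗ u ∘τ[ i , j ])
         (ℓv≡1+ℓu : ℓ v ≡ suc (ℓ u)) where

  cover-ascent : u ⟨$⟩ʳ i <ᶠ u ⟨$⟩ʳ j
  cover-ascent with Fin.<-cmp (u ⟨$⟩ʳ i) (u ⟨$⟩ʳ j)
  ... | tri< ui<uj _ _ = ui<uj
  ... | tri≈ _ ui≡uj _ = ⊥-elim (Fin.<⇒≢ i<j (⟨$⟩ʳ-injective u ui≡uj))
  ... | tri> _ _ uj<ui = ⊥-elim (ℕ.<-asym (ℕ.≤-reflexive (sym ℓv≡1+ℓu))
                                          (ℓ-increases-on-ascent i<j vi<vj (∘τ-sym v≗uτ)))
    where
    vi<vj : v ⟨$⟩ʳ i <ᶠ v ⟨$⟩ʳ j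
    vi<vj = subst₂ _<ᶠ_ (sym (∘τ-matchˡ v≗uτ)) (sym (∘τ-matchʳ v≗uτ)) uj<ui

  cover-no-middle-value : ∀ {m} → i <ᶠ m → m <ᶠ j → u ⟨$⟩ʳ i <ᶠ u ⟨$⟩ʳ m → ¬ (u ⟨$⟩ʳ m <ᶠ u ⟨$⟩ʳ j)
  cover-no-middle-value i<m m<j ui<um um<uj = ℕ.m+n≮n 1 (suc (ℓ u))
    (subst (3 + ℓ u ≤_) ℓv≡1+ℓu (ℓ-increases-by-3-over-middle i<m m<j ui<um um<uj v≗uτ))

Desc-reflected-by-cover : ∀ {n k k′} {u v : Perm n} → k′ ≤ k → KCover k′ u v → Desc k v → Desc k u
Desc-reflected-by-cover {u = u} {v} k′≤k (i , j , i<j , i<k′ , _ , v≐uτ , ℓv≡1+ℓu) v↘ x y k≤x x<y =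
  by-cases (x ≟ j) (y ≟ j)
  where
  open ℕ.≤-Reasoning

  v≗uτ : v ≗ u ∘τ[ i , j ]
  v≗uτ = mk∘τ v≐uτ

  i<x : i <ᶠ x
  i<x = ℕ.<-≤-trans i<k′ (ℕ.≤-trans k′≤k k≤x)

  u≡v-off-ij : ∀ {z} → i <ᶠ z → z ≢ j → u ⟨$⟩ʳ z ≡ v ⟨$⟩ʳ z
  u≡v-off-ij i<z z≢j = ∘τ-mismatch (∘τ-sym v≗uτ) (Fin.<⇒≢ i<z ∘ sym) z≢j

  by-cases : Dec (x ≡ j) → Dec (y ≡ j) → u ⟨$⟩ʳ y <ᶠ u ⟨$⟩ʳ x
  by-cases (yes refl) (yes refl) = ⊥-elim (Fin.<-irrefl refl x<y)
  by-cases (yes refl) (no y≢j) = begin-strict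
    toℕ (u ⟨$⟩ʳ y) ≡⟨ cong toℕ (u≡v-off-ij (Fin.<-trans i<x x<y) y≢j) ⟩
    toℕ (v ⟨$⟩ʳ y) <⟨ v↘ x y k≤x x<y ⟩
    toℕ (v ⟨$⟩ʳ x) ≡⟨ cong toℕ (∘τ-matchʳ v≗uτ) ⟩
    toℕ (u ⟨$⟩ʳ i) <⟨ cover-ascent i<j v≗uτ ℓv≡1+ℓu ⟩
    toℕ (u ⟨$⟩ʳ x) ∎
  by-cases (no x≢j) (yes refl) with Fin.<-cmp (u ⟨$⟩ʳ y) (u ⟨$⟩ʳ x)
  ... | tri< uy<ux _ _ = uy<ux
  ... | tri≈ _ uy≡ux _ = ⊥-elim (x≢j (sym (⟨$⟩ʳ-injective u uy≡ux)))
  ... | tri> _ _ ux<uy = ⊥-elim (cover-no-middle-value i<j v≗uτ ℓv≡1+ℓu i<x x<y ui<ux ux<uy)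
    where
    ui<ux : u ⟨$⟩ʳ i <ᶠ u ⟨$⟩ʳ x
    ui<ux = begin-strict
      toℕ (u ⟨$⟩ʳ i) ≡⟨ cong toℕ (∘τ-matchʳ v≗uτ) ⟨
      toℕ (v ⟨$⟩ʳ y) <⟨ v↘ x y k≤x x<y ⟩
      toℕ (v ⟨$⟩ʳ x) ≡⟨ cong toℕ (u≡v-off-ij i<x x≢j) ⟨
      toℕ (u ⟨$⟩ʳ x) ∎
  by-cases (no x≢j) (no y≢j) = begin-strict
    toℕ (u ⟨$⟩ʳ y) ≡⟨ cong toℕ (u≡v-off-ij (Fin.<-trans i<x x<y) y≢j) ⟩
    toℕ (v ⟨$⟩ʳ y) <⟨ v↘ x y k≤x x<y ⟩
    toℕ (v ⟨$⟩ʳ x) ≡⟨ cong toℕ (u≡v-off-ij i<x x≢j) ⟨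
    toℕ (u ⟨$⟩ʳ x) ∎

Desc-reflected-by-≤ : ∀ {n k k′} {u w : Perm n} → k′ ≤ k → u ≤[ k′ ] w → Desc k w → Desc k u
Desc-reflected-by-≤ k′≤k ε = id
Desc-reflected-by-≤ {u = u} k′≤k (_◅_ {j = v} u⋖v v≤w) =
  Desc-reflected-by-cover {u = u} {v} k′≤k u⋖v ∘ Desc-reflected-by-≤ k′≤k v≤w

lemma3p7 : (n k k′ : ℕ) → 1 ≤ k → k < n → 1 ≤ k′ → k′ < n → k′ ≤ k →
    (w u : Perm n) → Desc k w → u ≤[ k′ ] w → Desc k u
lemma3p7 n k k′ _ _ _ _ k′≤k w u w↘ u≤w = Desc-reflected-by-≤ k′≤k u≤w w↘
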